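{- Let $M$ be a preordered set and let $H$ be the free semilattice over $M$. Then for every minimal semilattice $S$ over $M$ there is a semilattice homomorphism $\sim$ from $H$ onto $S$ with $a\sim a$ for all $a\in M$.
   Context: A preordered set: set with reflexive transitive $\le$; $a\equiv b$ iff $a\le b$ and $b\le a$. A semilattice: preordered set in which any $a,b$ have a greatest lower bound, unique up to $\equiv$, denoted $a\wedge b$. $M$ is a part of $H$ if $M\subseteq H$ and the preorder of $M$ is the restriction of that of $H$; a semilattice $H$ with $M$ a part of it is a semilattice over $M$. It is minimal over $M$ if no proper subset $H_0\subsetneq H$ contains $M$ and is closed under taking meets (i.e. $a,b\in H_0$, $c\equiv a\wedge b$ imply $c\in H_0$). The free semilattice over $M$ is the minimal semilattice $H$ over $M$ (unique up to isomorphism over $M$) such that for all $a_1,\dots,a_n,b\in M$: $a_1\wedge\dots\wedge a_n\le b$ in $H$ iff $a_i\le b$ for some $i$. A homomorphism from a preordered set $A$ into a preordered set $A'$ is a relation $\sim\subseteq A\times A'$ such that every $a\in A$ has some $a'$ with $a\sim a'$; $a\sim a_1'$, $a_1'\equiv a_2'$ imply $a\sim a_2'$; and $a\sim a'$, $b\sim b'$, $a\le b$ imply $a'\le b'$. It is onto if every $a'\in A'$ has some $a$ with $a\sim a'$. Between semilattices it is a semilattice homomorphism if moreover $a\sim a'$, $b\sim b'$ imply $c\sim c'$ whenever $c\equiv a\wedge b$ and $c'\equiv a'\wedge b'$. -}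

module Defs where

open import Level using (Level; suc; _⊔_)
open import Data.Product using (Σ; ∃; _×_; _,_)
open import Data.List using (List; []; _∷_)
open import Data.List.Relation.Unary.Any using (Any)
open import Relation.Binary.PropositionalEquality using (_≡_)

record PreorderedSet (c : Level) : Set (suc c) where
  field
    Carrier : Set c
    _≤_     : Carrier → Carrier → Set c
    ≤-refl  : ∀ {a} → a ≤ a
    ≤-trans : ∀ {a b d} → a ≤ b → b ≤ d → a ≤ d

  _≈_ : Carrier → Carrier → Set c
  a ≈ b = (a ≤ b) × (b ≤ a)

-- A semilattice: a preordered set in which any a, b have a greatest
-- lower bound; we fix a choice a ∧ b of one (unique up to ≈).
record Semilattice (c : Level) : Set (suc c) where
  field
    preordered : PreorderedSet c
  open PreorderedSet preordered public
  field
    _∧_      : Carrier → Carrier → Carrier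
    ∧-lower₁ : ∀ a b → (a ∧ b) ≤ a
    ∧-lower₂ : ∀ a b → (a ∧ b) ≤ b
    ∧-great  : ∀ a b d → d ≤ a → d ≤ b → d ≤ (a ∧ b)

-- A semilattice over M: a semilattice H of which M is a part, i.e. M is
-- (via an injective inclusion ι) a subset of H carrying the restricted preorder.
record SemilatticeOver {c : Level} (M : PreorderedSet c) : Set (suc c) where
  open PreorderedSet M using () renaming (Carrier to |M|; _≤_ to _≤M_)
  field
    semilattice : Semilattice c
  open Semilattice semilattice public
  field
    ι           : |M| → Carrier
    ι-injective : ∀ {a b} → ι a ≡ ι b → a ≡ b
    ι-mono      : ∀ {a b} → a ≤M b → ι a ≤ ι b
    ι-reflect   : ∀ {a b} → ι a ≤ ι b → a ≤M b

module _ {c : Level} {M : PreorderedSet c} (H : SemilatticeOver M) where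
  open PreorderedSet M using () renaming (Carrier to |M|; _≤_ to _≤M_)
  open SemilatticeOver H

  MeetClosed : (Carrier → Set c) → Set c
  MeetClosed P = ∀ a b d → P a → P b → d ≈ (a ∧ b) → P d

  Minimal : Set (suc c)
  Minimal = (P : Carrier → Set c) → (∀ m → P (ι m)) → MeetClosed P → ∀ h → P h

  ⋀ : |M| → List |M| → Carrier
  ⋀ a []       = ι a
  ⋀ a (a' ∷ as) = ι a ∧ ⋀ a' as

  FreeProperty : Set c
  FreeProperty = ∀ (a : |M|) (as : List |M|) (b : |M|) →
    ((⋀ a as ≤ ι b → Any (_≤M b) (a ∷ as)) × (Any (_≤M b) (a ∷ as) → ⋀ a as ≤ ι b))

  IsFree : Set (suc c)
  IsFree = Minimal × FreeProperty

module _ {c : Level} (A A' : PreorderedSet c) where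
  private
    module A  = PreorderedSet A
    module A' = PreorderedSet A'

  record IsHomomorphism (_∼_ : A.Carrier → A'.Carrier → Set c) : Set c where
    field
      total    : ∀ a → ∃ λ a' → a ∼ a'
      ≈-closed : ∀ {a a₁' a₂'} → a ∼ a₁' → a₁' A'.≈ a₂' → a ∼ a₂'
      monotone : ∀ {a b a' b'} → a ∼ a' → b ∼ b' → a A.≤ b → a' A'.≤ b'

  Onto : (A.Carrier → A'.Carrier → Set c) → Set c
  Onto _∼_ = ∀ a' → ∃ λ a → a ∼ a'

module _ {c : Level} (S S' : Semilattice c) where
  private
    module S  = Semilattice S
    module S' = Semilattice S'

  record IsSemilatticeHomomorphism (_∼_ : S.Carrier → S'.Carrier → Set c) : Set c where
    field
      isHomomorphism : IsHomomorphism S.preordered S'.preordered _∼_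
      meet-preserving : ∀ {a b a' b' d d'} → a ∼ a' → b ∼ b' →
                        d S.≈ (a S.∧ b) → d' S'.≈ (a' S'.∧ b') → d ∼ d'

module Submission where

-- Idea of the proof.  Call a nonempty list of elements of M a *word*; in a
-- semilattice S over M a word w = x ∷ xs denotes the meet ⟦ w ⟧ = ⋀ x xs.
--
--  * In any semilattice over M, ⟦ w ⟧ is the greatest lower bound of the
--    letters of w; hence concatenation of words denotes the meet, and
--    ⟦ u ⟧ ≤ ⟦ v ⟧ holds as soon as u ≼ v ("every letter of v lies above
--    some letter of u").
--  * If S is minimal over M, every element of S is ≈ to the value of a word,
--    since the represented elements contain M and are closed under meets.
--  * If H is free, the converse holds in H: ⟦ u ⟧ ≤ ⟦ v ⟧ implies u ≼ v.
--
-- The homomorphism relates h ∈ H to s ∈ S when both are (up to ≈) the value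
-- of one and the same word.  Minimality of H and S gives totality and
-- surjectivity, freeness of H gives monotonicity (through ≼), and
-- concatenation of words gives preservation of meets.

open import Defs
open import Level using (Level)
open import Data.Product using (∃; _×_; Σ; _,_; proj₁)
open import Data.Sum using (_⊎_; inj₁; inj₂)
open import Data.List using (List; []; _∷_; _++_)
open import Data.List.Relation.Unary.Any using (Any; here; there)
open import Data.List.Membership.Propositional using (_∈_; find)
open import Data.List.Membership.Propositional.Properties using (∈-++⁺ˡ; ∈-++⁺ʳ; ∈-++⁻)
open import Relation.Binary.PropositionalEquality using (refl)

module EquivalenceProperties {c : Level} (P : PreorderedSet c) where
  open PreorderedSet P

  ≈-refl : ∀ {a} → a ≈ a
  ≈-refl = ≤-refl , ≤-refl

  ≈-sym : ∀ {a b} → a ≈ b → b ≈ a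
  ≈-sym (a≤b , b≤a) = b≤a , a≤b

  ≈-trans : ∀ {a b d} → a ≈ b → b ≈ d → a ≈ d
  ≈-trans (a≤b , b≤a) (b≤d , d≤b) = ≤-trans a≤b b≤d , ≤-trans d≤b b≤a

module MeetProperties {c : Level} (S : Semilattice c) where
  open Semilattice S

  ∧-mono : ∀ {a a' b b'} → a ≤ a' → b ≤ b' → (a ∧ b) ≤ (a' ∧ b')
  ∧-mono {a} {a'} {b} {b'} a≤a' b≤b' =
    ∧-great a' b' (a ∧ b) (≤-trans (∧-lower₁ a b) a≤a') (≤-trans (∧-lower₂ a b) b≤b')

  ∧-cong : ∀ {a a' b b'} → a ≈ a' → b ≈ b' → (a ∧ b) ≈ (a' ∧ b')
  ∧-cong (a≤a' , a'≤a) (b≤b' , b'≤b) = ∧-mono a≤a' b≤b' , ∧-mono a'≤a b'≤b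

module Words {c : Level} (M : PreorderedSet c) where
  open PreorderedSet M using () renaming (Carrier to |M|; _≤_ to _≤M_)

  Word : Set c
  Word = |M| × List |M|

  letters : Word → List |M|
  letters (x , xs) = x ∷ xs

  _·_ : Word → Word → Word
  (x , xs) · (y , ys) = x , xs ++ y ∷ ys

  _≼_ : Word → Word → Set c
  u ≼ v = ∀ {z} → z ∈ letters v → Any (_≤M z) (letters u)

  ∈-·⁻ : ∀ {z} u v → z ∈ letters (u · v) → z ∈ letters u ⊎ z ∈ letters v
  ∈-·⁻ (x , xs) v (here z≡x) = inj₁ (here z≡x)
  ∈-·⁻ (x , xs) v (there z∈rest) with ∈-++⁻ xs z∈rest
  ... | inj₁ z∈xs = inj₁ (there z∈xs)
  ... | inj₂ z∈v  = inj₂ z∈v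

  ∈-·⁺ˡ : ∀ {z} u v → z ∈ letters u → z ∈ letters (u · v)
  ∈-·⁺ˡ (x , xs) v (here z≡x)  = here z≡x
  ∈-·⁺ˡ (x , xs) v (there z∈xs) = there (∈-++⁺ˡ z∈xs)

  ∈-·⁺ʳ : ∀ {z} u v → z ∈ letters v → z ∈ letters (u · v)
  ∈-·⁺ʳ (x , xs) v z∈v = there (∈-++⁺ʳ xs z∈v)

module Interpretation {c : Level} {M : PreorderedSet c} (S : SemilatticeOver M) where
  open PreorderedSet M using () renaming (_≤_ to _≤M_)
  open SemilatticeOver S
  open EquivalenceProperties preordered
  open MeetProperties semilattice
  open Words M

  ⟦_⟧ : Word → Carrier
  ⟦ x , xs ⟧ = ⋀ S x xs

  ⟦⟧-lower : ∀ {z} w → z ∈ letters w → ⟦ w ⟧ ≤ ι z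
  ⟦⟧-lower (x , xs) = go x xs
    where
    go : ∀ {z} x xs → z ∈ x ∷ xs → ⋀ S x xs ≤ ι z
    go x []        (here refl)  = ≤-refl
    go x (x' ∷ xs) (here refl)  = ∧-lower₁ (ι x) (⋀ S x' xs)
    go x (x' ∷ xs) (there z∈w) = ≤-trans (∧-lower₂ (ι x) (⋀ S x' xs)) (go x' xs z∈w)

  ⟦⟧-greatest : ∀ {d} w → (∀ {z} → z ∈ letters w → d ≤ ι z) → d ≤ ⟦ w ⟧
  ⟦⟧-greatest (x , xs) = go x xs
    where
    go : ∀ {d} x xs → (∀ {z} → z ∈ x ∷ xs → d ≤ ι z) → d ≤ ⋀ S x xs
    go x []        below = below (here refl)
    go x (x' ∷ xs) below =
      ∧-great (ι x) (⋀ S x' xs) _ (below (here refl)) (go x' xs (λ z∈w → below (there z∈w)))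

  -- If some letter of w lies below z then ⟦ w ⟧ ≤ z: the "easy" half of
  -- the free property, valid in every semilattice over M.
  ⟦⟧-below : ∀ {z} w → Any (_≤M z) (letters w) → ⟦ w ⟧ ≤ ι z
  ⟦⟧-below w some with find some
  ... | y , y∈w , y≤z = ≤-trans (⟦⟧-lower w y∈w) (ι-mono y≤z)

  ⟦⟧-mono : ∀ u v → u ≼ v → ⟦ u ⟧ ≤ ⟦ v ⟧
  ⟦⟧-mono u v u≼v = ⟦⟧-greatest v (λ z∈v → ⟦⟧-below u (u≼v z∈v))

  ⟦⟧-· : ∀ u v → ⟦ u · v ⟧ ≈ (⟦ u ⟧ ∧ ⟦ v ⟧)
  ⟦⟧-· u v =
    ∧-great ⟦ u ⟧ ⟦ v ⟧ _
      (⟦⟧-greatest u (λ z∈u → ⟦⟧-lower (u · v) (∈-·⁺ˡ u v z∈u)))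
      (⟦⟧-greatest v (λ z∈v → ⟦⟧-lower (u · v) (∈-·⁺ʳ u v z∈v))) ,
    ⟦⟧-greatest (u · v) below-letters
    where
    below-letters : ∀ {z} → z ∈ letters (u · v) → (⟦ u ⟧ ∧ ⟦ v ⟧) ≤ ι z
    below-letters z∈uv with ∈-·⁻ u v z∈uv
    ... | inj₁ z∈u = ≤-trans (∧-lower₁ ⟦ u ⟧ ⟦ v ⟧) (⟦⟧-lower u z∈u)
    ... | inj₂ z∈v = ≤-trans (∧-lower₂ ⟦ u ⟧ ⟦ v ⟧) (⟦⟧-lower v z∈v)

  meet-of-words : ∀ {a b d} u v → d ≈ (a ∧ b) → a ≈ ⟦ u ⟧ → b ≈ ⟦ v ⟧ → d ≈ ⟦ u · v ⟧
  meet-of-words u v d≈a∧b a≈u b≈v =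
    ≈-trans d≈a∧b (≈-trans (∧-cong a≈u b≈v) (≈-sym (⟦⟧-· u v)))

  Represented : Carrier → Set c
  Represented h = Σ Word λ w → h ≈ ⟦ w ⟧

  -- In a minimal semilattice over M every element is the value of a word,
  -- since the represented elements contain M and are closed under meets.
  represented : Minimal S → ∀ h → Represented h
  represented minimal =
    minimal Represented (λ m → (m , []) , ≈-refl)
      (λ a b d (u , a≈u) (v , b≈v) d≈a∧b → u · v , meet-of-words u v d≈a∧b a≈u b≈v)

free-reflects : ∀ {c} {M : PreorderedSet c} (H : SemilatticeOver M) → FreeProperty H →
                let open Interpretation H; open Words M in
                ∀ u v → SemilatticeOver._≤_ H ⟦ u ⟧ ⟦ v ⟧ → u ≼ v
free-reflects H free (x , xs) v u≤v z∈v =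
  proj₁ (free x xs _) (≤-trans u≤v (⟦⟧-lower v z∈v))
  where
  open SemilatticeOver H
  open Interpretation H

module WordCorrespondence {c : Level} {M : PreorderedSet c} (H S : SemilatticeOver M) where
  open Words M
  module H = SemilatticeOver H
  module S = SemilatticeOver S
  module ⟦H⟧ = Interpretation H
  module ⟦S⟧ = Interpretation S
  module ≈H = EquivalenceProperties H.preordered
  module ≈S = EquivalenceProperties S.preordered

  _∼_ : H.Carrier → S.Carrier → Set c
  h ∼ s = Σ Word λ w → (h H.≈ ⟦H⟧.⟦ w ⟧) × (s S.≈ ⟦S⟧.⟦ w ⟧)

  ∼-≈-closed : ∀ {h s₁ s₂} → h ∼ s₁ → s₁ S.≈ s₂ → h ∼ s₂
  ∼-≈-closed (w , h≈w , s₁≈w) s₁≈s₂ =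
    w , h≈w , ≈S.≈-trans (≈S.≈-sym s₁≈s₂) s₁≈w

  ∼-meet : ∀ {a b a' b' d d'} → a ∼ a' → b ∼ b' →
           d H.≈ (a H.∧ b) → d' S.≈ (a' S.∧ b') → d ∼ d'
  ∼-meet (u , a≈u , a'≈u) (v , b≈v , b'≈v) d≈ d'≈ =
    u · v , ⟦H⟧.meet-of-words u v d≈ a≈u b≈v , ⟦S⟧.meet-of-words u v d'≈ a'≈u b'≈v

  -- Monotonicity needs H free: ≤ between words in H is reflected to ≼,
  -- which every semilattice over M preserves.
  ∼-monotone : FreeProperty H → ∀ {a b a' b'} → a ∼ a' → b ∼ b' → a H.≤ b → a' S.≤ b'
  ∼-monotone free (u , (_ , u≤a) , (a'≤u , _)) (v , (b≤v , _) , (_ , v≤b')) a≤b =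
    S.≤-trans a'≤u (S.≤-trans (⟦S⟧.⟦⟧-mono u v (free-reflects H free u v u≤v)) v≤b')
    where
    u≤v : ⟦H⟧.⟦ u ⟧ H.≤ ⟦H⟧.⟦ v ⟧
    u≤v = H.≤-trans u≤a (H.≤-trans a≤b b≤v)

  ∼-total : Minimal H → ∀ h → ∃ λ s → h ∼ s
  ∼-total minimal h with ⟦H⟧.represented minimal h
  ... | w , h≈w = ⟦S⟧.⟦ w ⟧ , w , h≈w , ≈S.≈-refl

  ∼-onto : Minimal S → ∀ s → ∃ λ h → h ∼ s
  ∼-onto minimal s with ⟦S⟧.represented minimal s
  ... | w , s≈w = ⟦H⟧.⟦ w ⟧ , w , ≈H.≈-refl , s≈w

  ∼-on-M : ∀ m → H.ι m ∼ S.ι m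
  ∼-on-M m = (m , []) , ≈H.≈-refl , ≈S.≈-refl

theorem4 : {c : Level} (M : PreorderedSet c) (H : SemilatticeOver M) →
    IsFree H →
    (S : SemilatticeOver M) → Minimal S →
    ∃ λ (_∼_ : SemilatticeOver.Carrier H → SemilatticeOver.Carrier S → Set c) →
      IsSemilatticeHomomorphism (SemilatticeOver.semilattice H) (SemilatticeOver.semilattice S) _∼_
      × Onto (SemilatticeOver.preordered H) (SemilatticeOver.preordered S) _∼_
      × (∀ a → SemilatticeOver.ι H a ∼ SemilatticeOver.ι S a)
theorem4 M H (minimalH , free) S minimalS = _∼_ , homomorphism , ∼-onto minimalS , ∼-on-M
  where
  open WordCorrespondence H S

  homomorphism : IsSemilatticeHomomorphism H.semilattice S.semilattice _∼_
  homomorphism = record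
    { isHomomorphism  = record
      { total    = ∼-total minimalH
      ; ≈-closed = ∼-≈-closed
      ; monotone = ∼-monotone free
      }
    ; meet-preserving = ∼-meet
    }
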